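{- Let $r$ be an integer and for integers $n,k\ge 0$ put $$T(n,k,r)=\sum_{j\ge 0}\binom{k}{j}\binom{n-k}{j}r^j .$$ Define the generalized Catalan numbers $c(n;r)=T(2n,n,r)-T(2n,n+1,r)$ for $n\ge 0$. Then the Hankel transform of $(c(n;r))_{n\ge0}$ is $h_n=r^{\binom{n+1}{2}}$ for all $n\ge 0$.
   Context: Binomial coefficients $\binom{a}{j}$ with $j>a$ (or $a<0$ in $\binom{n-k}{j}$ for $k>n$) are zero for the relevant cases; explicitly $T(2n,n+1,r)=\sum_{j\ge0}\binom{n+1}{j}\binom{n-1}{j}r^j$. The Hankel transform of a sequence $(a_n)_{n\ge 0}$ is the sequence $(h_n)_{n\ge 0}$ with $h_n=\det\big(a_{i+j}\big)_{0\le i,j\le n}$. The convention $0^0=1$ is used. For $r=1$, $c(n;1)$ are the Catalan numbers. -}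

module Defs where

open import Data.Nat using (ℕ; zero; suc; _∸_; _≤ᵇ_)
open import Data.Nat.Combinatorics using (_C_)
open import Data.Integer using (ℤ; +_; -_; _+_; _-_; _*_; _^_)
open import Data.Bool using (if_then_else_)
open import Data.Fin using (Fin; zero; suc; toℕ; punchIn)

sumTo : ℕ → (ℕ → ℤ) → ℤ
sumTo zero    f = f 0
sumTo (suc m) f = sumTo m f + f (suc m)

-- binom(n - k, j) with the convention that it is 0 when k > n
-- (i.e. n - k < 0), as stated in the context.
binomDiff : ℕ → ℕ → ℕ → ℕ
binomDiff n k j = if k ≤ᵇ n then (n ∸ k) C j else 0

-- T(n,k,r) = Σ_{j≥0} C(k,j) C(n-k,j) r^j ; terms with j > k vanish.
T : ℕ → ℕ → ℤ → ℤ
T n k r = sumTo k (λ j → (+ (k C j)) * (+ binomDiff n k j) * (r ^ j))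

catalan : ℤ → ℕ → ℤ
catalan r n = T (2 Data.Nat.* n) n r - T (2 Data.Nat.* n) (suc n) r
  where import Data.Nat

det : (n : ℕ) → (Fin n → Fin n → ℤ) → ℤ
det zero    M = + 1
det (suc n) M = go n (λ i → i)
  where
    minor : Fin (suc n) → Fin n → Fin n → ℤ
    minor c i j = M (suc i) (punchIn c j)
    sign : ℕ → ℤ
    sign k = (- (+ 1)) ^ k
    go : (m : ℕ) → (Fin (suc m) → Fin (suc n)) → ℤ
    go zero    col = sign (toℕ (col zero)) * M zero (col zero) * det n (minor (col zero))
    go (suc m) col = sign (toℕ (col zero)) * M zero (col zero) * det n (minor (col zero))
                     + go m (λ i → col (suc i))

hankel : (ℕ → ℤ) → ℕ → ℤ
hankel a n = det (suc n) (λ i j → a (toℕ i Data.Nat.+ toℕ j))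
  where import Data.Nat

{-# OPTIONS --safe #-}

-- The numbers c(n;r) are the moments of the Jacobi continued fraction with
-- b₀ = r, bₖ = 1 + r and λₖ = r: if L is its Stieltjes table (row n of L is
-- Jⁿe₀ for the tridiagonal matrix J), then c(n;r) = L(n,0), which follows
-- from a closed form of L in binomial sums.  Because every λₖ equals r, J is
-- self-adjoint for the weights rᵏ, whence c(i+j;r) = ∑ₖ L(i,k) rᵏ L(j,k).
-- The Hankel matrix is therefore L · diag(rᵏ) · Lᵀ with L unit lower
-- triangular, and its determinant is ∏_{k≤n} rᵏ = r^C(n+1,2).

module Submission where

open import Defs
open import Data.Nat using (ℕ; suc)
open import Data.Nat.Combinatorics using (_C_)
open import Data.Nat.Combinatorics using (nCk+nC[k+1]≡[n+1]C[k+1]; k>n⇒nCk≡0; nC1≡n)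
open import Data.Integer using (ℤ; _^_)
open import Relation.Binary.PropositionalEquality using (_≡_)

open import Data.Nat as ℕ using (zero; _<_; _≤_; z≤n; s≤s; _<ᵇ_; _≤ᵇ_; _≡ᵇ_)
import Data.Nat.Properties as ℕₚ
import Data.Fin.Properties as Finₚ
open import Data.Integer using (+_; -[1+_]; -_; _+_; _-_; _*_; 0ℤ; 1ℤ; -1ℤ)
import Data.Integer.Properties as ℤₚ
open import Data.Integer.Tactic.RingSolver using (solve-∀)
open import Algebra.Properties.Semiring.Sum ℤₚ.+-*-semiring
  using (sum; sum-cong-≗; sum-replicate-zero; ∑-distrib-+; ∑-comm; *-distribˡ-sum; *-distribʳ-sum)
open import Data.Fin as Fin using (Fin; toℕ; punchIn)
open import Data.List using (List; []; _∷_; length; tabulate; applyUpTo; upTo)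
open import Data.List.Properties using (length-tabulate; length-applyUpTo)
open import Data.List.Membership.Propositional using (_∈_)
open import Data.List.Relation.Unary.Any using (here; there)
open import Data.Bool using (true; false; if_then_else_) renaming (T to IsTrue)
open import Data.Sum using (inj₁; inj₂)
open import Relation.Binary.Definitions using (tri<; tri≈; tri>)
open import Relation.Nullary using (yes; no)
open import Data.Empty using (⊥-elim)
open import Function using (_∘_)
open import Relation.Binary.PropositionalEquality
  using (_≢_; refl; sym; trans; cong; cong₂; cong-app; subst; module ≡-Reasoning)

cong₃ : ∀ (f : ℤ → ℤ → ℤ → ℤ) {x x′ y y′ z z′} →
        x ≡ x′ → y ≡ y′ → z ≡ z′ → f x y z ≡ f x′ y′ z′
cong₃ f refl refl refl = refl

cong₄ : ∀ (f : ℤ → ℤ → ℤ → ℤ → ℤ) {x x′ y y′ z z′ w w′} →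
        x ≡ x′ → y ≡ y′ → z ≡ z′ → w ≡ w′ → f x y z w ≡ f x′ y′ z′ w′
cong₄ f refl refl refl refl = refl

-- Finite sums and products

∑ : ℕ → (ℕ → ℤ) → ℤ
∑ n f = sum {n} (f ∘ toℕ)

∑-cong : ∀ n {f g : ℕ → ℤ} → (∀ i → f i ≡ g i) → ∑ n f ≡ ∑ n g
∑-cong n f≗g = sum-cong-≗ {n} (f≗g ∘ toℕ)

∑-cong-< : ∀ n {f g : ℕ → ℤ} → (∀ i → i < n → f i ≡ g i) → ∑ n f ≡ ∑ n g
∑-cong-< n f≗g = sum-cong-≗ {n} (λ i → f≗g (toℕ i) (Finₚ.toℕ<n i))

∑-zero : ∀ n {f : ℕ → ℤ} → (∀ i → i < n → f i ≡ 0ℤ) → ∑ n f ≡ 0ℤ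
∑-zero n f≗0 = trans (∑-cong-< n f≗0) (sum-replicate-zero n)

∑-+ : ∀ n (f g : ℕ → ℤ) → ∑ n (λ i → f i + g i) ≡ ∑ n f + ∑ n g
∑-+ n f g = ∑-distrib-+ {n} (f ∘ toℕ) (g ∘ toℕ)

∑-*ˡ : ∀ n x (f : ℕ → ℤ) → x * ∑ n f ≡ ∑ n (λ i → x * f i)
∑-*ˡ n x f = *-distribˡ-sum {n} x (f ∘ toℕ)

∑-neg : ∀ n (f : ℕ → ℤ) → ∑ n (λ i → - f i) ≡ - ∑ n f
∑-neg zero    f = refl
∑-neg (suc n) f = trans (cong (_+_ (- f 0)) (∑-neg n (f ∘ suc))) (sym (ℤₚ.neg-distrib-+ (f 0) _))

∑-difference : ∀ n (f g : ℕ → ℤ) → ∑ n (λ i → f i - g i) ≡ ∑ n f - ∑ n g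
∑-difference n f g = trans (∑-+ n f (λ i → - g i)) (cong (_+_ (∑ n f)) (∑-neg n g))

∑-last : ∀ n (f : ℕ → ℤ) → ∑ (suc n) f ≡ ∑ n f + f n
∑-last zero    f = trans (ℤₚ.+-identityʳ (f 0)) (sym (ℤₚ.+-identityˡ (f 0)))
∑-last (suc n) f = trans (cong (_+_ (f 0)) (∑-last n (f ∘ suc))) (sym (ℤₚ.+-assoc (f 0) _ _))

∑-swap : ∀ m n (f : ℕ → ℕ → ℤ) → ∑ m (λ i → ∑ n (f i)) ≡ ∑ n (λ j → ∑ m (λ i → f i j))
∑-swap m n f = ∑-comm {m} {n} (λ i j → f (toℕ i) (toℕ j))

∑-single : ∀ n k {f : ℕ → ℤ} → k < n → (∀ i → i < n → i ≢ k → f i ≡ 0ℤ) → ∑ n f ≡ f k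
∑-single (suc n) zero {f} _ others =
  trans (cong (_+_ (f 0)) (∑-zero n (λ i i<n → others (suc i) (s≤s i<n) λ ()))) (ℤₚ.+-identityʳ (f 0))
∑-single (suc n) (suc k) {f} (s≤s k<n) others =
  trans (cong (_+ ∑ n (f ∘ suc)) (others 0 (s≤s z≤n) λ ()))
  (trans (ℤₚ.+-identityˡ _)
         (∑-single n k k<n (λ i i<n i≢k → others (suc i) (s≤s i<n) (i≢k ∘ ℕₚ.suc-injective))))

∑-∑-*ˡ : ∀ l m (a : ℕ → ℤ) (T : ℕ → ℕ → ℤ) →
         ∑ l (λ i → ∑ m (λ k → a k * T k i)) ≡ ∑ m (λ k → a k * ∑ l (T k))
∑-∑-*ˡ l m a T = trans (∑-swap l m (λ i k → a k * T k i)) (∑-cong m λ k → sym (∑-*ˡ l (a k) (T k)))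

∑-telescope : ∀ n (F : ℕ → ℤ) → ∑ n (λ k → F k - F (suc k)) ≡ F 0 - F n
∑-telescope zero    F = sym (ℤₚ.+-inverseʳ (F 0))
∑-telescope (suc n) F = trans (cong (_+_ (F 0 - F 1)) (∑-telescope n (F ∘ suc))) (cancel (F 0) (F 1) (F (suc n)))
  where
  cancel : ∀ a b c → a - b + (b - c) ≡ a - c
  cancel = solve-∀

∏ : ℕ → (ℕ → ℤ) → ℤ
∏ zero    f = 1ℤ
∏ (suc n) f = f 0 * ∏ n (f ∘ suc)

∏-cong : ∀ m {f g : ℕ → ℤ} → (∀ i → f i ≡ g i) → ∏ m f ≡ ∏ m g
∏-cong zero    f≗g = refl
∏-cong (suc m) f≗g = cong₂ _*_ (f≗g 0) (∏-cong m (f≗g ∘ suc))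

∏-last : ∀ m (f : ℕ → ℤ) → ∏ (suc m) f ≡ ∏ m f * f m
∏-last zero    f = trans (ℤₚ.*-identityʳ (f 0)) (sym (ℤₚ.*-identityˡ (f 0)))
∏-last (suc m) f = trans (cong (_*_ (f 0)) (∏-last m (f ∘ suc))) (sym (ℤₚ.*-assoc (f 0) _ _))

∏-powers : ∀ r n → ∏ (suc n) (r ^_) ≡ r ^ (suc n C 2)
∏-powers r zero    = refl
∏-powers r (suc n) = begin
  ∏ (2 ℕ.+ n) (r ^_)                 ≡⟨ ∏-last (suc n) (r ^_) ⟩
  ∏ (suc n) (r ^_) * r ^ suc n       ≡⟨ cong (_* r ^ suc n) (∏-powers r n) ⟩
  r ^ (suc n C 2) * r ^ suc n        ≡⟨ sym (ℤₚ.^-distribˡ-+-* r (suc n C 2) (suc n)) ⟩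
  r ^ (suc n C 2 ℕ.+ suc n)          ≡⟨ cong (r ^_) triangular ⟩
  r ^ (suc (suc n) C 2)              ∎
  where
  open ≡-Reasoning
  triangular : suc n C 2 ℕ.+ suc n ≡ suc (suc n) C 2
  triangular = trans (ℕₚ.+-comm (suc n C 2) (suc n))
               (trans (cong (ℕ._+ suc n C 2) (sym (nC1≡n (suc n)))) (nCk+nC[k+1]≡[n+1]C[k+1] (suc n) 1))

-- Determinants as Laplace expansions over lists of columns

Matrix : Set
Matrix = ℕ → ℕ → ℤ

sign : ℕ → ℤ
sign k = -1ℤ ^ k

nth : List ℕ → ℕ → ℕ
nth []       _       = 0
nth (c ∷ cs) zero    = c
nth (c ∷ cs) (suc i) = nth cs i

deleteNth : ℕ → List ℕ → List ℕ
deleteNth _       []       = []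
deleteNth zero    (c ∷ cs) = cs
deleteNth (suc i) (c ∷ cs) = c ∷ deleteNth i cs

-- The minor of R on rows 0 … n-1 and the columns listed in cs, expanded
-- along its first row (a determinant when length cs ≡ n).
laplace : ℕ → Matrix → List ℕ → ℤ
laplace zero    R cs = 1ℤ
laplace (suc n) R cs =
  ∑ (length cs) λ i → sign i * R 0 (nth cs i) * laplace n (R ∘ suc) (deleteNth i cs)

laplace-cong : ∀ n {R R′ : Matrix} cs → (∀ a → a < n → ∀ c → R a c ≡ R′ a c) →
               laplace n R cs ≡ laplace n R′ cs
laplace-cong zero    cs R≗R′ = refl
laplace-cong (suc n) cs R≗R′ = ∑-cong (length cs) λ i →
  cong₂ (λ x y → sign i * x * y) (R≗R′ 0 (s≤s z≤n) (nth cs i))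
        (laplace-cong n (deleteNth i cs) (λ a a<n → R≗R′ (suc a) (s≤s a<n)))

nth-tabulate : ∀ {m} (g : Fin m → ℕ) t → nth (tabulate g) (toℕ t) ≡ g t
nth-tabulate g Fin.zero    = refl
nth-tabulate g (Fin.suc t) = nth-tabulate (g ∘ Fin.suc) t

deleteNth-tabulate : ∀ {m} (g : Fin (suc m) → ℕ) t →
                     deleteNth (toℕ t) (tabulate g) ≡ tabulate (g ∘ punchIn t)
deleteNth-tabulate         g Fin.zero    = refl
deleteNth-tabulate {suc m} g (Fin.suc t) = cong (g Fin.zero ∷_) (deleteNth-tabulate (g ∘ Fin.suc) t)

-- `det` sums its Laplace expansion with a where-bound loop, which cannot be
-- named from outside.  `detLoop` is a metavariable that the unifier
-- instantiates to that loop: unfolding `det` at size 3 + n on the zero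
-- matrix and abstracting the arguments leaves the loop applied to distinct
-- variables, so the constraint has a unique solution.
mutual
  detLoop : (n : ℕ) → (Fin (suc n) → Fin (suc n) → ℤ) → (m : ℕ) → (Fin (suc m) → Fin (suc n)) → ℤ
  detLoop = _

  private
    detLoop-solution : ∀ n → det (3 ℕ.+ n) (λ _ _ → 0ℤ) ≡ det (3 ℕ.+ n) (λ _ _ → 0ℤ)
    detLoop-solution n
      with suc (suc n) | (λ (_ _ : Fin (3 ℕ.+ n)) → 0ℤ) | (λ (i : Fin (suc n)) → Fin.suc (Fin.suc i)) | _+_ 0ℤ
    ... | size | M | col | 0ℤ+_ = refl {x = 0ℤ+ (0ℤ+ detLoop size M n col)}

detTerm : (n : ℕ) → (Fin (suc n) → Fin (suc n) → ℤ) → Fin (suc n) → ℤ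
detTerm n M c = sign (toℕ c) * M Fin.zero c * det n (λ i j → M (Fin.suc i) (punchIn c j))

detLoop-sum : ∀ n M m (col : Fin (suc m) → Fin (suc n)) → detLoop n M m col ≡ sum (detTerm n M ∘ col)
detLoop-sum n M zero    col = sym (ℤₚ.+-identityʳ _)
detLoop-sum n M (suc m) col = cong (_+_ (detTerm n M (col Fin.zero))) (detLoop-sum n M m (col ∘ Fin.suc))

det≡laplace : ∀ m (R : Matrix) (g : Fin m → ℕ) →
              det m (λ i j → R (toℕ i) (g j)) ≡ laplace m R (tabulate g)
det≡laplace zero    R g = refl
det≡laplace (suc n) R g = begin
  det (suc n) M                  ≡⟨ detLoop-sum n M n (λ c → c) ⟩
  sum (detTerm n M)              ≡⟨ sum-cong-≗ {suc n} detTerm≡ ⟩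
  ∑ (suc n) term                 ≡⟨ cong (λ k → ∑ k term) (sym (length-tabulate g)) ⟩
  laplace (suc n) R (tabulate g) ∎
  where
  open ≡-Reasoning
  M : Fin (suc n) → Fin (suc n) → ℤ
  M i j = R (toℕ i) (g j)
  term : ℕ → ℤ
  term i = sign i * R 0 (nth (tabulate g) i) * laplace n (R ∘ suc) (deleteNth i (tabulate g))
  detTerm≡ : ∀ t → detTerm n M t ≡ term (toℕ t)
  detTerm≡ t = cong₂ (λ c d → sign (toℕ t) * R 0 c * d) (sym (nth-tabulate g t))
    (trans (det≡laplace n (R ∘ suc) (g ∘ punchIn t))
           (cong (laplace n (R ∘ suc)) (sym (deleteNth-tabulate g t))))

tabulate-toℕ : ∀ {A : Set} n (f : ℕ → A) → tabulate {n = n} (f ∘ toℕ) ≡ applyUpTo f n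
tabulate-toℕ zero    f = refl
tabulate-toℕ (suc n) f = cong (f 0 ∷_) (tabulate-toℕ n (f ∘ suc))

nth-deleteNth-< : ∀ cs {i j} → j < i → nth (deleteNth i cs) j ≡ nth cs j
nth-deleteNth-< []                          j<i       = refl
nth-deleteNth-< (c ∷ cs) {suc i} {zero}    _         = refl
nth-deleteNth-< (c ∷ cs) {suc i} {suc j}   (s≤s j<i) = nth-deleteNth-< cs j<i

nth-deleteNth-≥ : ∀ cs {i j} → i ≤ j → nth (deleteNth i cs) j ≡ nth cs (suc j)
nth-deleteNth-≥ []                        i≤j       = refl
nth-deleteNth-≥ (c ∷ cs) {zero}           i≤j       = refl
nth-deleteNth-≥ (c ∷ cs) {suc i} {suc j}  (s≤s i≤j) = nth-deleteNth-≥ cs i≤j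

deleteNth-deleteNth : ∀ cs {i j} → i ≤ j →
                      deleteNth j (deleteNth i cs) ≡ deleteNth i (deleteNth (suc j) cs)
deleteNth-deleteNth []                        i≤j       = refl
deleteNth-deleteNth (c ∷ cs) {zero}           i≤j       = refl
deleteNth-deleteNth (c ∷ cs) {suc i} {suc j}  (s≤s i≤j) = cong (c ∷_) (deleteNth-deleteNth cs i≤j)

length-deleteNth : ∀ c cs {i} → i ≤ length cs → length (deleteNth i (c ∷ cs)) ≡ length cs
length-deleteNth c cs       {zero}  _         = refl
length-deleteNth c (d ∷ cs) {suc i} (s≤s i≤l) = cong suc (length-deleteNth d cs i≤l)

if-<ᵇ-yes : ∀ {A : Set} {a b} (x y : A) → a < b → (if a <ᵇ b then x else y) ≡ x
if-<ᵇ-yes {a = zero}  {suc b} x y _         = refl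
if-<ᵇ-yes {a = suc a} {suc b} x y (s≤s a<b) = if-<ᵇ-yes {a = a} {b} x y a<b

if-<ᵇ-no : ∀ {A : Set} {a b} (x y : A) → b ≤ a → (if a <ᵇ b then x else y) ≡ y
if-<ᵇ-no {a = a}     {zero}  x y _         = refl
if-<ᵇ-no {a = suc a} {suc b} x y (s≤s b≤a) = if-<ᵇ-no {a = a} {b} x y b≤a

when< : ℕ → ℕ → ℤ → ℤ
when< a b x = if a <ᵇ b then x else 0ℤ

when<-neg : ∀ a b x → when< a b (- x) ≡ - when< a b x
when<-neg a b x with a <ᵇ b
... | true  = refl
... | false = refl

-- Laplace expansion along the first two rows x and y, over column pairs a < b.
pairTerm : ℕ → Matrix → List ℕ → (x y : ℕ → ℤ) → ℕ → ℕ → ℤ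
pairTerm n Rl cs x y a b =
  sign a * sign b * (y (nth cs a) * x (nth cs b) - x (nth cs a) * y (nth cs b))
  * laplace n Rl (deleteNth a (deleteNth b cs))

pairExpansion : ℕ → Matrix → List ℕ → (x y : ℕ → ℤ) → ℤ
pairExpansion n Rl cs x y =
  ∑ (length cs) λ b → ∑ (length cs) λ a → when< a b (pairTerm n Rl cs x y a b)

pairExpansion-antisym : ∀ n Rl cs x y → pairExpansion n Rl cs y x ≡ - pairExpansion n Rl cs x y
pairExpansion-antisym n Rl cs x y = begin
  (∑ l λ b → ∑ l λ a → when< a b (pairTerm n Rl cs y x a b))
    ≡⟨ ∑-cong l (λ b → ∑-cong l λ a → flip a b) ⟩
  (∑ l λ b → ∑ l λ a → - when< a b (term a b))
    ≡⟨ ∑-cong l (λ b → ∑-neg l λ a → when< a b (term a b)) ⟩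
  (∑ l λ b → - ∑ l λ a → when< a b (term a b))
    ≡⟨ ∑-neg l (λ b → ∑ l λ a → when< a b (term a b)) ⟩
  - pairExpansion n Rl cs x y ∎
  where
  open ≡-Reasoning
  l = length cs
  term = pairTerm n Rl cs x y
  swap-2×2 : ∀ s t xa xb ya yb P →
             s * t * (xa * yb - ya * xb) * P ≡ - (s * t * (ya * xb - xa * yb) * P)
  swap-2×2 = solve-∀
  flip : ∀ a b → when< a b (pairTerm n Rl cs y x a b) ≡ - when< a b (term a b)
  flip a b = trans (cong (when< a b) (swap-2×2 (sign a) (sign b) (x (nth cs a)) (x (nth cs b))
                                                (y (nth cs a)) (y (nth cs b)) _))
                   (when<-neg a b (term a b))

module _ (n : ℕ) (R : Matrix) (c : ℕ) (cs′ : List ℕ) where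
  private
    cs = c ∷ cs′
    K = length cs
    x = R 0
    y = R 1
    Rl = R ∘ suc ∘ suc

    minor₂ : ℕ → ℕ → ℤ
    minor₂ a b = laplace n Rl (deleteNth a (deleteNth b cs))

    -- the terms of the row-y expansion of the minor without column i, split
    -- by whether the column used lies left (a < i) or right (i < b) of i
    left right : ℕ → ℕ → ℤ
    left  a i = sign a * y (nth cs a) * minor₂ a i
    right i b = - (sign b * y (nth cs b) * minor₂ i b)

    rowTerm : ℕ → ℕ → ℤ
    rowTerm i j = sign j * y (nth (deleteNth i cs) j) * laplace n Rl (deleteNth j (deleteNth i cs))

    rowTerm-split : ∀ i j → rowTerm i j ≡ when< j i (left j i) + when< i (suc j) (right i (suc j))
    rowTerm-split i j with ℕₚ.<-≤-connex j i
    ... | inj₁ j<i = begin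
      rowTerm i j
        ≡⟨ cong (λ d → sign j * y d * minor₂ j i) (nth-deleteNth-< cs j<i) ⟩
      left j i
        ≡⟨ sym (ℤₚ.+-identityʳ _) ⟩
      left j i + 0ℤ
        ≡⟨ sym (cong₂ _+_ (if-<ᵇ-yes (left j i) 0ℤ j<i) (if-<ᵇ-no (right i (suc j)) 0ℤ j<i)) ⟩
      when< j i (left j i) + when< i (suc j) (right i (suc j)) ∎
      where open ≡-Reasoning
    ... | inj₂ i≤j = begin
      rowTerm i j
        ≡⟨ cong₂ (λ d D → sign j * y d * laplace n Rl D) (nth-deleteNth-≥ cs i≤j) (deleteNth-deleteNth cs i≤j) ⟩
      sign j * y (nth cs (suc j)) * minor₂ i (suc j)
        ≡⟨ sign-shift (sign j) (y (nth cs (suc j))) (minor₂ i (suc j)) ⟩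
      0ℤ + right i (suc j)
        ≡⟨ sym (cong₂ _+_ (if-<ᵇ-no (left j i) 0ℤ i≤j) (if-<ᵇ-yes (right i (suc j)) 0ℤ (s≤s i≤j))) ⟩
      when< j i (left j i) + when< i (suc j) (right i (suc j)) ∎
      where
      open ≡-Reasoning
      sign-shift : ∀ s Y P → s * Y * P ≡ 0ℤ + - (-1ℤ * s * Y * P)
      sign-shift = solve-∀

    leftSum rightSum : ℕ → ℤ
    leftSum  i = ∑ K (λ a → when< a i (left a i))
    rightSum i = ∑ K (λ b → when< i b (right i b))

    rowExpansion : ∀ i → i < K → laplace (suc n) (R ∘ suc) (deleteNth i cs) ≡ leftSum i + rightSum i
    rowExpansion i (s≤s i≤k′) = begin
      ∑ (length (deleteNth i cs)) (rowTerm i)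
        ≡⟨ cong (λ l → ∑ l (rowTerm i)) (length-deleteNth c cs′ i≤k′) ⟩
      ∑ k′ (rowTerm i)
        ≡⟨ trans (∑-cong k′ (rowTerm-split i)) (∑-+ k′ leftTerm rightTerm) ⟩
      ∑ k′ leftTerm + ∑ k′ rightTerm
        ≡⟨ cong₂ _+_ (sym lastVanishes) (sym (ℤₚ.+-identityˡ _)) ⟩
      leftSum i + rightSum i ∎
      where
      open ≡-Reasoning
      k′ = length cs′
      leftTerm rightTerm : ℕ → ℤ
      leftTerm  a = when< a i (left a i)
      rightTerm j = when< i (suc j) (right i (suc j))
      lastVanishes : leftSum i ≡ ∑ k′ leftTerm
      lastVanishes = trans (∑-last k′ leftTerm)
        (trans (cong (_+_ (∑ k′ leftTerm)) (if-<ᵇ-no (left k′ i) 0ℤ i≤k′)) (ℤₚ.+-identityʳ _))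

    sx : ℕ → ℤ
    sx i = sign i * x (nth cs i)

    combine : ∀ a b → sx b * when< a b (left a b) + sx a * when< a b (right a b) ≡ when< a b (pairTerm n Rl cs x y a b)
    combine a b with a <ᵇ b
    ... | true  = expand (sign a) (sign b) (x (nth cs a)) (x (nth cs b)) (y (nth cs a)) (y (nth cs b)) (minor₂ a b)
      where
      expand : ∀ sa sb xa xb ya yb P →
               sb * xb * (sa * ya * P) + sa * xa * (- (sb * yb * P)) ≡ sa * sb * (ya * xb - xa * yb) * P
      expand = solve-∀
    ... | false = vanish (sx b) (sx a)
      where
      vanish : ∀ u v → u * 0ℤ + v * 0ℤ ≡ 0ℤ
      vanish = solve-∀

  laplace-pairExpansion : laplace (2 ℕ.+ n) R cs ≡ pairExpansion n Rl cs x y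
  laplace-pairExpansion = begin
    ∑ K (λ i → sx i * laplace (suc n) (R ∘ suc) (deleteNth i cs))
      ≡⟨ ∑-cong-< K (λ i i<K → cong (_*_ (sx i)) (rowExpansion i i<K)) ⟩
    ∑ K (λ i → sx i * (leftSum i + rightSum i))
      ≡⟨ ∑-cong K (λ i → trans (ℤₚ.*-distribˡ-+ (sx i) (leftSum i) (rightSum i))
                              (cong₂ _+_ (∑-*ˡ K (sx i) (λ a → L a i)) (∑-*ˡ K (sx i) (R′ i)))) ⟩
    ∑ K (λ i → ∑ K (λ a → sx i * L a i) + ∑ K (λ b → sx i * R′ i b))
      ≡⟨ ∑-+ K (λ b → ∑ K (λ a → sx b * L a b)) (λ a → ∑ K (λ b → sx a * R′ a b)) ⟩
    ∑ K (λ b → ∑ K (λ a → sx b * L a b)) + ∑ K (λ a → ∑ K (λ b → sx a * R′ a b))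
      ≡⟨ cong (_+_ (∑ K (λ b → ∑ K (λ a → sx b * L a b)))) (∑-swap K K (λ a b → sx a * R′ a b)) ⟩
    ∑ K (λ b → ∑ K (λ a → sx b * L a b)) + ∑ K (λ b → ∑ K (λ a → sx a * R′ a b))
      ≡⟨ sym (∑-+ K (λ b → ∑ K (λ a → sx b * L a b)) (λ b → ∑ K (λ a → sx a * R′ a b))) ⟩
    ∑ K (λ b → ∑ K (λ a → sx b * L a b) + ∑ K (λ a → sx a * R′ a b))
      ≡⟨ ∑-cong K (λ b → trans (sym (∑-+ K (λ a → sx b * L a b) (λ a → sx a * R′ a b)))
                              (∑-cong K λ a → combine a b)) ⟩
    pairExpansion n Rl cs x y ∎
    where
    open ≡-Reasoning
    L R′ : ℕ → ℕ → ℤ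
    L  a b = when< a b (left a b)
    R′ a b = when< a b (right a b)

swapRows : ℕ → ℕ → Matrix → Matrix
swapRows a b R k = if k ≡ᵇ a then R b else if k ≡ᵇ b then R a else R k

laplace-swapRows₀₁ : ∀ n R cs → laplace (2 ℕ.+ n) (swapRows 0 1 R) cs ≡ - laplace (2 ℕ.+ n) R cs
laplace-swapRows₀₁ n R []       = refl
laplace-swapRows₀₁ n R (c ∷ cs) =
  trans (laplace-pairExpansion n (swapRows 0 1 R) c cs)
  (trans (pairExpansion-antisym n (R ∘ suc ∘ suc) (c ∷ cs) (R 0) (R 1))
         (cong -_ (sym (laplace-pairExpansion n R c cs))))

-- `laplace-swapRows-suc` is split off so that every recursive call decreases n.
mutual
  laplace-swapRows : ∀ n a b R cs → a < b → b < n → laplace n (swapRows a b R) cs ≡ - laplace n R cs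
  laplace-swapRows (suc (suc n)) zero (suc zero) R cs _ _ = laplace-swapRows₀₁ n R cs
  laplace-swapRows (suc (suc n)) zero (suc (suc b)) R cs _ b<n = begin
    laplace N (swapRows 0 (2 ℕ.+ b) R) cs
      ≡⟨ laplace-cong N cs (λ k _ c → conjugate k c) ⟩
    laplace N (swapRows 0 1 R′) cs
      ≡⟨ laplace-swapRows₀₁ n R′ cs ⟩
    - laplace N R′ cs
      ≡⟨ cong -_ (laplace-swapRows-suc (suc n) 0 (suc b) (swapRows 0 1 R) cs (s≤s z≤n) (ℕₚ.≤-pred b<n)) ⟩
    - - laplace N (swapRows 0 1 R) cs
      ≡⟨ ℤₚ.neg-involutive _ ⟩
    laplace N (swapRows 0 1 R) cs
      ≡⟨ laplace-swapRows₀₁ n R cs ⟩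
    - laplace N R cs ∎
    where
    open ≡-Reasoning
    N = 2 ℕ.+ n
    R′ = swapRows 1 (2 ℕ.+ b) (swapRows 0 1 R)
    conjugate : ∀ k c → swapRows 0 (2 ℕ.+ b) R k c ≡ swapRows 0 1 R′ k c
    conjugate zero          c = refl
    conjugate (suc zero)    c = refl
    conjugate (suc (suc k)) c = refl
  laplace-swapRows (suc n) (suc a) (suc b) R cs (s≤s a<b) (s≤s b<n) = laplace-swapRows-suc n a b R cs a<b b<n

  laplace-swapRows-suc : ∀ n a b R cs → a < b → b < n →
                         laplace (suc n) (swapRows (suc a) (suc b) R) cs ≡ - laplace (suc n) R cs
  laplace-swapRows-suc n a b R cs a<b b<n =
    trans (∑-cong (length cs) λ i →
             trans (cong (_*_ (sign i * R 0 (nth cs i))) (laplace-swapRows n a b (R ∘ suc) (deleteNth i cs) a<b b<n))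
                   (sym (ℤₚ.neg-distribʳ-* (sign i * R 0 (nth cs i)) (laplace n (R ∘ suc) (deleteNth i cs)))))
          (∑-neg (length cs) λ i → sign i * R 0 (nth cs i) * laplace n (R ∘ suc) (deleteNth i cs))

≡ᵇ-true⇒≡ : ∀ {m n} → (m ≡ᵇ n) ≡ true → m ≡ n
≡ᵇ-true⇒≡ {m} {n} eq = ℕₚ.≡ᵇ⇒≡ m n (subst IsTrue (sym eq) _)

swapRows-equalRows : ∀ {a b} (R : Matrix) → (∀ c → R a c ≡ R b c) → ∀ k c → swapRows a b R k c ≡ R k c
swapRows-equalRows {a} {b} R Ra≡Rb k c with k ≡ᵇ a in k≡a | k ≡ᵇ b in k≡b
... | true  | _     = trans (sym (Ra≡Rb c)) (cong (λ j → R j c) (sym (≡ᵇ-true⇒≡ k≡a)))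
... | false | true  = trans (Ra≡Rb c) (cong (λ j → R j c) (sym (≡ᵇ-true⇒≡ k≡b)))
... | false | false = refl

x≡-x⇒x≡0 : ∀ x → x ≡ - x → x ≡ 0ℤ
x≡-x⇒x≡0 (+ zero)   _  = refl
x≡-x⇒x≡0 (+ suc k)  ()
x≡-x⇒x≡0 -[1+ k ]   ()

laplace-equalRows : ∀ n {a b} R cs → a < b → b < n → (∀ c → R a c ≡ R b c) → laplace n R cs ≡ 0ℤ
laplace-equalRows n {a} {b} R cs a<b b<n Ra≡Rb = x≡-x⇒x≡0 _
  (trans (laplace-cong n cs (λ k _ c → sym (swapRows-equalRows R Ra≡Rb k c)))
         (laplace-swapRows n a b R cs a<b b<n))

updateRow : ℕ → (ℕ → ℤ) → Matrix → Matrix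
updateRow p v R k = if k ≡ᵇ p then v else R k

updateRow-at : ∀ p v R → updateRow p v R p ≡ v
updateRow-at zero    v R = refl
updateRow-at (suc p) v R = updateRow-at p v (R ∘ suc)

updateRow-other : ∀ {p a} v R → a ≢ p → updateRow p v R a ≡ R a
updateRow-other {zero}  {zero}  v R a≢p = ⊥-elim (a≢p refl)
updateRow-other {zero}  {suc a} v R _   = refl
updateRow-other {suc p} {zero}  v R _   = refl
updateRow-other {suc p} {suc a} v R a≢p = updateRow-other v (R ∘ suc) (a≢p ∘ cong suc)

laplace-linear : ∀ n p m R cs (a : ℕ → ℤ) (V : Matrix) → p < n →
  laplace n (updateRow p (λ c → ∑ m (λ k → a k * V k c)) R) cs
  ≡ ∑ m (λ k → a k * laplace n (updateRow p (V k) R) cs)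
laplace-linear (suc n) zero m R cs a V _ =
  trans (∑-cong l λ i → pull (sign i) (laplace n (R ∘ suc) (deleteNth i cs)) (λ k → V k (nth cs i)))
        (∑-∑-*ˡ l m a λ k i → sign i * V k (nth cs i) * laplace n (R ∘ suc) (deleteNth i cs))
  where
  l = length cs
  reassoc : ∀ s t x y → s * (x * y) * t ≡ x * (s * y * t)
  reassoc = solve-∀
  pull : ∀ s t (y : ℕ → ℤ) → s * ∑ m (λ k → a k * y k) * t ≡ ∑ m (λ k → a k * (s * y k * t))
  pull s t y = trans (cong (_* t) (∑-*ˡ m s (λ k → a k * y k)))
              (trans (*-distribʳ-sum {m} t (λ k → s * (a (toℕ k) * y (toℕ k))))
                     (∑-cong m λ k → reassoc s t (a k) (y k)))
laplace-linear (suc n) (suc p) m R cs a V (s≤s p<n) =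
  trans (∑-cong l λ i → trans (cong (_*_ (x i)) (laplace-linear n p m (R ∘ suc) (deleteNth i cs) a V p<n))
                              (pull (x i) (λ k → minor k i)))
        (∑-∑-*ˡ l m a λ k i → x i * minor k i)
  where
  l = length cs
  x : ℕ → ℤ
  x i = sign i * R 0 (nth cs i)
  minor : ℕ → ℕ → ℤ
  minor k i = laplace n (updateRow p (V k) (R ∘ suc)) (deleteNth i cs)
  reassoc : ∀ s x y → s * (x * y) ≡ x * (s * y)
  reassoc = solve-∀
  pull : ∀ s (y : ℕ → ℤ) → s * ∑ m (λ k → a k * y k) ≡ ∑ m (λ k → a k * (s * y k))
  pull s y = trans (∑-*ˡ m s (λ k → a k * y k)) (∑-cong m λ k → reassoc s (a k) (y k))

-- The rows of L·U are replaced by those of U from the top down.  Expanding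
-- row m linearly, the terms k < m repeat the (already replaced) row k and the
-- terms k > m carry L m k = 0, so only L m m = 1 survives.
module _ (n : ℕ) (L U : Matrix) (cs : List ℕ)
         (L-diag : ∀ a → L a a ≡ 1ℤ) (L-upper : ∀ {a k} → a < k → L a k ≡ 0ℤ) where
  private
    LU : Matrix
    LU a c = ∑ n (λ k → L a k * U k c)

    mixed : ℕ → Matrix
    mixed m a = if a <ᵇ m then U a else LU a

    mixed-update : ∀ m a → mixed m a ≡ updateRow m (LU m) (mixed (suc m)) a
    mixed-update m a with ℕₚ.<-cmp a m
    ... | tri< a<m a≢m _ = begin
      mixed m a                                 ≡⟨ if-<ᵇ-yes (U a) (LU a) a<m ⟩
      U a                                       ≡⟨ sym (if-<ᵇ-yes (U a) (LU a) (ℕₚ.m<n⇒m<1+n a<m)) ⟩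
      mixed (suc m) a                           ≡⟨ sym (updateRow-other (LU m) (mixed (suc m)) a≢m) ⟩
      updateRow m (LU m) (mixed (suc m)) a      ∎
      where open ≡-Reasoning
    ... | tri≈ _ refl _ = begin
      mixed a a                                 ≡⟨ if-<ᵇ-no (U a) (LU a) (ℕₚ.≤-refl {a}) ⟩
      LU a                                      ≡⟨ sym (updateRow-at a (LU a) (mixed (suc a))) ⟩
      updateRow a (LU a) (mixed (suc a)) a      ∎
      where open ≡-Reasoning
    ... | tri> _ a≢m m<a = begin
      mixed m a                                 ≡⟨ if-<ᵇ-no (U a) (LU a) (ℕₚ.<⇒≤ m<a) ⟩
      LU a                                      ≡⟨ sym (if-<ᵇ-no (U a) (LU a) m<a) ⟩
      mixed (suc m) a                           ≡⟨ sym (updateRow-other (LU m) (mixed (suc m)) a≢m) ⟩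
      updateRow m (LU m) (mixed (suc m)) a      ∎
      where open ≡-Reasoning

    mixed-restore : ∀ m a → updateRow m (U m) (mixed (suc m)) a ≡ mixed (suc m) a
    mixed-restore m a with a ℕₚ.≟ m
    ... | yes refl = trans (updateRow-at a (U a) (mixed (suc a))) (sym (if-<ᵇ-yes (U a) (LU a) (ℕₚ.n<1+n a)))
    ... | no a≢m   = updateRow-other (U m) (mixed (suc m)) a≢m

    otherRows-vanish : ∀ m → m < n → ∀ k → k < n → k ≢ m →
                       L m k * laplace n (updateRow m (U k) (mixed (suc m))) cs ≡ 0ℤ
    otherRows-vanish m m<n k _ k≢m with ℕₚ.<-≤-connex k m
    ... | inj₁ k<m = trans (cong (_*_ (L m k)) (laplace-equalRows n R cs k<m m<n (cong-app rowk≡rowm)))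
                           (ℤₚ.*-zeroʳ (L m k))
      where
      R = updateRow m (U k) (mixed (suc m))
      rowk≡rowm : R k ≡ R m
      rowk≡rowm = begin
        R k              ≡⟨ updateRow-other (U k) (mixed (suc m)) k≢m ⟩
        mixed (suc m) k  ≡⟨ if-<ᵇ-yes (U k) (LU k) (ℕₚ.m<n⇒m<1+n k<m) ⟩
        U k              ≡⟨ sym (updateRow-at m (U k) (mixed (suc m))) ⟩
        R m              ∎
        where open ≡-Reasoning
    ... | inj₂ m≤k = trans (cong (_* minor) (L-upper (ℕₚ.≤∧≢⇒< m≤k (k≢m ∘ sym)))) (ℤₚ.*-zeroˡ minor)
      where minor = laplace n (updateRow m (U k) (mixed (suc m))) cs

    step : ∀ m → m < n → laplace n (mixed m) cs ≡ laplace n (mixed (suc m)) cs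
    step m m<n = begin
      laplace n (mixed m) cs
        ≡⟨ laplace-cong n cs (λ a _ → cong-app (mixed-update m a)) ⟩
      laplace n (updateRow m (LU m) (mixed (suc m))) cs
        ≡⟨ laplace-linear n m n (mixed (suc m)) cs (L m) U m<n ⟩
      ∑ n (λ k → L m k * laplace n (updateRow m (U k) (mixed (suc m))) cs)
        ≡⟨ ∑-single n m m<n (otherRows-vanish m m<n) ⟩
      L m m * laplace n (updateRow m (U m) (mixed (suc m))) cs
        ≡⟨ cong₂ _*_ (L-diag m) (laplace-cong n cs (λ a _ → cong-app (mixed-restore m a))) ⟩
      1ℤ * laplace n (mixed (suc m)) cs
        ≡⟨ ℤₚ.*-identityˡ _ ⟩
      laplace n (mixed (suc m)) cs ∎
      where open ≡-Reasoning

    reduce : ∀ m → m ≤ n → laplace n LU cs ≡ laplace n (mixed m) cs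
    reduce zero    _   = refl
    reduce (suc m) m<n = trans (reduce m (ℕₚ.<⇒≤ m<n)) (step m m<n)

  laplace-unitLowerTriangular-* : laplace n (λ a c → ∑ n (λ k → L a k * U k c)) cs ≡ laplace n U cs
  laplace-unitLowerTriangular-* =
    trans (reduce n ℕₚ.≤-refl) (laplace-cong n cs (λ a a<n → cong-app (if-<ᵇ-yes (U a) (LU a) a<n)))

∈-deleteNth : ∀ {c} cs i → c ∈ cs → nth cs i ≢ c → c ∈ deleteNth i cs
∈-deleteNth (d ∷ cs) zero    (here refl)  d≢c = ⊥-elim (d≢c refl)
∈-deleteNth (d ∷ cs) zero    (there c∈cs) _   = c∈cs
∈-deleteNth (d ∷ cs) (suc i) (here refl)  _   = here refl
∈-deleteNth (d ∷ cs) (suc i) (there c∈cs) ≢c  = there (∈-deleteNth cs i c∈cs ≢c)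

laplace-zeroColumn : ∀ n V cs {c} → length cs ≡ n → c ∈ cs → (∀ a → V a c ≡ 0ℤ) → laplace n V cs ≡ 0ℤ
laplace-zeroColumn (suc n) V (d ∷ cs) {c} len c∈cs Vc≡0 = ∑-zero (suc (length cs)) term≡0
  where
  minor : ℕ → ℤ
  minor i = laplace n (V ∘ suc) (deleteNth i (d ∷ cs))
  vanish : ∀ s M → s * 0ℤ * M ≡ 0ℤ
  vanish = solve-∀
  term≡0 : ∀ i → i < suc (length cs) → sign i * V 0 (nth (d ∷ cs) i) * minor i ≡ 0ℤ
  term≡0 i (s≤s i≤l) with nth (d ∷ cs) i ℕₚ.≟ c
  ... | yes refl = trans (cong (λ v → sign i * v * minor i) (Vc≡0 0)) (vanish (sign i) (minor i))
  ... | no ≢c    = trans (cong (_*_ (sign i * V 0 (nth (d ∷ cs) i)))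
                               (laplace-zeroColumn n (V ∘ suc) (deleteNth i (d ∷ cs))
                                  (trans (length-deleteNth d cs i≤l) (ℕₚ.suc-injective len))
                                  (∈-deleteNth (d ∷ cs) i c∈cs ≢c) (Vc≡0 ∘ suc)))
                         (ℤₚ.*-zeroʳ (sign i * V 0 (nth (d ∷ cs) i)))

laplace-upperTriangular : ∀ m (V : Matrix) (f : ℕ → ℕ) →
  (∀ {a b} → a < b → f a < f b) → (∀ {a c} → c < f a → V a c ≡ 0ℤ) →
  laplace m V (applyUpTo f m) ≡ ∏ m (λ a → V a (f a))
laplace-upperTriangular zero    V f _      _       = refl
laplace-upperTriangular (suc m) V f f-mono V-upper = begin
  diagonalTerm + ∑ (length cols) offDiagonalTerm
    ≡⟨ cong₂ _+_ (cong (_* laplace m (V ∘ suc) cols) (ℤₚ.*-identityˡ (V 0 (f 0))))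
                 (∑-zero (length cols) offDiagonal≡0) ⟩
  V 0 (f 0) * laplace m (V ∘ suc) cols + 0ℤ
    ≡⟨ ℤₚ.+-identityʳ _ ⟩
  V 0 (f 0) * laplace m (V ∘ suc) cols
    ≡⟨ cong (_*_ (V 0 (f 0))) (laplace-upperTriangular m (V ∘ suc) (f ∘ suc) (f-mono ∘ s≤s) V-upper) ⟩
  ∏ (suc m) (λ a → V a (f a)) ∎
  where
  open ≡-Reasoning
  cols = applyUpTo (f ∘ suc) m
  diagonalTerm = sign 0 * V 0 (f 0) * laplace m (V ∘ suc) cols
  offDiagonalTerm : ℕ → ℤ
  offDiagonalTerm i = sign (suc i) * V 0 (nth cols i) * laplace m (V ∘ suc) (f 0 ∷ deleteNth i cols)
  offDiagonal≡0 : ∀ i → i < length cols → offDiagonalTerm i ≡ 0ℤ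
  offDiagonal≡0 i i<l = trans
    (cong (_*_ (sign (suc i) * V 0 (nth cols i)))
          (laplace-zeroColumn m (V ∘ suc) (f 0 ∷ deleteNth i cols)
             (trans (length-deleteNth (f 0) cols i<l) (length-applyUpTo (f ∘ suc) m))
             (here refl) (λ a → V-upper (f-mono (s≤s z≤n)))))
    (ℤₚ.*-zeroʳ (sign (suc i) * V 0 (nth cols i)))

-- The Stieltjes table of the continued fraction

shiftDown : (ℕ → ℤ) → ℕ → ℤ
shiftDown u zero    = 0ℤ
shiftDown u (suc k) = u k

jacobiDiagonal : ℤ → ℕ → ℤ
jacobiDiagonal r zero    = r
jacobiDiagonal r (suc k) = 1ℤ + r

jacobi : ℤ → (ℕ → ℤ) → ℕ → ℤ
jacobi r u k = shiftDown u k + jacobiDiagonal r k * u k + r * u (suc k)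

stieltjes : ℤ → ℕ → ℕ → ℤ
stieltjes r zero    zero    = 1ℤ
stieltjes r zero    (suc k) = 0ℤ
stieltjes r (suc n) k       = jacobi r (stieltjes r n) k

stieltjes-upper : ∀ r {n k} → n < k → stieltjes r n k ≡ 0ℤ
stieltjes-upper r {zero}  {suc k} _         = refl
stieltjes-upper r {suc n} {suc k} (s≤s n<k) =
  trans (cong₃ (λ x y z → x + jacobiDiagonal r (suc k) * y + r * z)
               (stieltjes-upper r n<k) (stieltjes-upper r n<1+k) (stieltjes-upper r (ℕₚ.m<n⇒m<1+n n<1+k)))
        (vanish (jacobiDiagonal r (suc k)) r)
  where
  n<1+k = ℕₚ.m<n⇒m<1+n n<k
  vanish : ∀ b r → 0ℤ + b * 0ℤ + r * 0ℤ ≡ 0ℤ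
  vanish = solve-∀

stieltjes-diagonal : ∀ r n → stieltjes r n n ≡ 1ℤ
stieltjes-diagonal r zero    = refl
stieltjes-diagonal r (suc n) =
  trans (cong₃ (λ x y z → x + jacobiDiagonal r (suc n) * y + r * z)
               (stieltjes-diagonal r n) (stieltjes-upper r n<1+n) (stieltjes-upper r (ℕₚ.m<n⇒m<1+n n<1+n)))
        (unit (jacobiDiagonal r (suc n)) r)
  where
  n<1+n = ℕₚ.n<1+n n
  unit : ∀ b r → 1ℤ + b * 0ℤ + r * 0ℤ ≡ 1ℤ
  unit = solve-∀

-- The defect of symmetry telescopes to the boundary term F K, which the
-- hypotheses on u make vanish.
jacobi-selfAdjoint : ∀ r M (u v : ℕ → ℤ) → u M ≡ 0ℤ → u (suc M) ≡ 0ℤ →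
  ∑ (suc M) (λ k → jacobi r u k * r ^ k * v k) ≡ ∑ (suc M) (λ k → u k * r ^ k * jacobi r v k)
jacobi-selfAdjoint r M u v uM≡0 uSM≡0 = ℤₚ.i-j≡0⇒i≡j _ _ (begin
  ∑ K Ju·v - ∑ K u·Jv                 ≡⟨ sym (∑-difference K Ju·v u·Jv) ⟩
  ∑ K (λ k → Ju·v k - u·Jv k)         ≡⟨ ∑-cong K defect≡ ⟩
  ∑ K (λ k → F k - F (suc k))         ≡⟨ ∑-telescope K F ⟩
  F 0 - F K                           ≡⟨ cong₂ _-_ (vanish₀ (u 0) (v 0))
                                                   (cong₂ (λ a b → r ^ K * (a * v K - b * v M)) uM≡0 uSM≡0) ⟩
  0ℤ - r ^ K * (0ℤ * v K - 0ℤ * v M)  ≡⟨ vanishK (r ^ K) (v K) (v M) ⟩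
  0ℤ                                  ∎)
  where
  open ≡-Reasoning
  K = suc M
  Ju·v u·Jv : ℕ → ℤ
  Ju·v k = jacobi r u k * r ^ k * v k
  u·Jv k = u k * r ^ k * jacobi r v k
  F : ℕ → ℤ
  F k = r ^ k * (shiftDown u k * v k - u k * shiftDown v k)
  telescoping : ∀ p q x y x₁ y₁ b r w →
    (p + b * x + r * x₁) * w * y - x * w * (q + b * y + r * y₁) ≡ w * (p * y - x * q) - r * w * (x * y₁ - x₁ * y)
  telescoping = solve-∀
  defect≡ : ∀ k → Ju·v k - u·Jv k ≡ F k - F (suc k)
  defect≡ k = telescoping (shiftDown u k) (shiftDown v k) (u k) (v k) (u (suc k)) (v (suc k)) (jacobiDiagonal r k) r (r ^ k)
  vanish₀ : ∀ x y → 1ℤ * (0ℤ * y - x * 0ℤ) ≡ 0ℤ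
  vanish₀ = solve-∀
  vanishK : ∀ w x y → 0ℤ - w * (0ℤ * x - 0ℤ * y) ≡ 0ℤ
  vanishK = solve-∀

stieltjes-moments : ∀ r i j N → i < N →
                    ∑ N (λ k → stieltjes r i k * r ^ k * stieltjes r j k) ≡ stieltjes r (i ℕ.+ j) 0
stieltjes-moments r zero j (suc N) _ =
  trans (cong₂ _+_ (ℤₚ.*-identityˡ (stieltjes r j 0)) (∑-zero N λ k _ → vanish (r ^ suc k) (stieltjes r j (suc k))))
        (ℤₚ.+-identityʳ (stieltjes r j 0))
  where
  vanish : ∀ w y → 0ℤ * w * y ≡ 0ℤ
  vanish = solve-∀
stieltjes-moments r (suc i) j (suc M) (s≤s i<M) = begin
  ∑ (suc M) (λ k → jacobi r (stieltjes r i) k * r ^ k * stieltjes r j k)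
    ≡⟨ jacobi-selfAdjoint r M (stieltjes r i) (stieltjes r j)
         (stieltjes-upper r i<M) (stieltjes-upper r (ℕₚ.m<n⇒m<1+n i<M)) ⟩
  ∑ (suc M) (λ k → stieltjes r i k * r ^ k * stieltjes r (suc j) k)
    ≡⟨ stieltjes-moments r i (suc j) (suc M) (ℕₚ.m<n⇒m<1+n i<M) ⟩
  stieltjes r (i ℕ.+ suc j) 0
    ≡⟨ cong (λ n → stieltjes r n 0) (ℕₚ.+-suc i j) ⟩
  stieltjes r (suc i ℕ.+ j) 0 ∎
  where open ≡-Reasoning

-- Binomial sums

binom : ℕ → ℕ → ℤ
binom a j = + (a C j)

binom-pascal : ∀ a j → binom (suc a) (suc j) ≡ binom a j + binom a (suc j)
binom-pascal a j = cong +_ (sym (nCk+nC[k+1]≡[n+1]C[k+1] a j))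

binomialSum : ℤ → ℕ → ℕ → (ℕ → ℤ) → ℤ
binomialSum r K a g = ∑ K (λ j → binom a j * g j * r ^ j)

binomialSum-cong : ∀ r K a {g h : ℕ → ℤ} → (∀ j → g j ≡ h j) → binomialSum r K a g ≡ binomialSum r K a h
binomialSum-cong r K a g≗h = ∑-cong K λ j → cong (λ z → binom a j * z * r ^ j) (g≗h j)

binomialSum-+ : ∀ r K a (g h : ℕ → ℤ) →
                binomialSum r K a (λ j → g j + h j) ≡ binomialSum r K a g + binomialSum r K a h
binomialSum-+ r K a g h =
  trans (∑-cong K λ j → distrib (binom a j) (g j) (h j) (r ^ j))
        (∑-+ K (λ j → binom a j * g j * r ^ j) (λ j → binom a j * h j * r ^ j))
  where
  distrib : ∀ b x y w → b * (x + y) * w ≡ b * x * w + b * y * w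
  distrib = solve-∀

binomialSum-extend : ∀ r a d g → binomialSum r (d ℕ.+ suc a) a g ≡ binomialSum r (suc a) a g
binomialSum-extend r a zero    g = refl
binomialSum-extend r a (suc d) g = begin
  binomialSum r (suc (d ℕ.+ suc a)) a g
    ≡⟨ ∑-last (d ℕ.+ suc a) (λ j → binom a j * g j * r ^ j) ⟩
  binomialSum r (d ℕ.+ suc a) a g + binom a j * g j * r ^ j
    ≡⟨ cong (λ b → binomialSum r (d ℕ.+ suc a) a g + b * g j * r ^ j) (cong +_ (k>n⇒nCk≡0 a<j)) ⟩
  binomialSum r (d ℕ.+ suc a) a g + 0ℤ * g j * r ^ j
    ≡⟨ vanish _ (g j) (r ^ j) ⟩
  binomialSum r (d ℕ.+ suc a) a g
    ≡⟨ binomialSum-extend r a d g ⟩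
  binomialSum r (suc a) a g ∎
  where
  open ≡-Reasoning
  j = d ℕ.+ suc a
  a<j : a < j
  a<j = ℕₚ.m≤n+m (suc a) d
  vanish : ∀ s x w → s + 0ℤ * x * w ≡ s
  vanish = solve-∀

binomialSum-pascal : ∀ r K a (g : ℕ → ℤ) →
  binomialSum r (suc K) (suc a) g ≡ binomialSum r (suc K) a g + r * binomialSum r K a (g ∘ suc)
binomialSum-pascal r K a g = begin
  h₀ + ∑ K (λ j → binom (suc a) (suc j) * g (suc j) * r ^ suc j)
    ≡⟨ cong (_+_ h₀) (∑-cong K split) ⟩
  h₀ + ∑ K (λ j → r * lower j + upper j)
    ≡⟨ cong (_+_ h₀) (trans (∑-+ K (λ j → r * lower j) upper) (cong (_+ ∑ K upper) (sym (∑-*ˡ K r lower)))) ⟩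
  h₀ + (r * ∑ K lower + ∑ K upper)
    ≡⟨ regroup h₀ (∑ K upper) (∑ K lower) r ⟩
  (h₀ + ∑ K upper) + r * ∑ K lower ∎
  where
  open ≡-Reasoning
  h₀ = binom a 0 * g 0 * r ^ 0
  lower upper : ℕ → ℤ
  lower j = binom a j * g (suc j) * r ^ j
  upper j = binom a (suc j) * g (suc j) * r ^ suc j
  pascal-term : ∀ x y z r w → (x + y) * z * (r * w) ≡ r * (x * z * w) + y * z * (r * w)
  pascal-term = solve-∀
  split : ∀ j → binom (suc a) (suc j) * g (suc j) * r ^ suc j ≡ r * lower j + upper j
  split j = trans (cong (λ b → b * g (suc j) * r ^ suc j) (binom-pascal a j))
                  (pascal-term (binom a j) (binom a (suc j)) (g (suc j)) r (r ^ j))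
  regroup : ∀ h A B r → h + (r * B + A) ≡ (h + A) + r * B
  regroup = solve-∀

shiftedSum : ℤ → ℕ → ℕ → ℤ
shiftedSum r a s = binomialSum r (suc a) a (λ j → binom a (s ℕ.+ j))

shiftedSum-suc : ∀ r a s → let S = shiftedSum r a in
  shiftedSum r (suc a) (suc s) ≡ (S s + S (suc s)) + r * (S (suc s) + S (2 ℕ.+ s))
shiftedSum-suc r a s = begin
  shiftedSum r (suc a) (suc s)
    ≡⟨ binomialSum-pascal r (suc a) a (λ j → binom (suc a) (suc s ℕ.+ j)) ⟩
  binomialSum r (2 ℕ.+ a) a (λ j → binom (suc a) (suc (s ℕ.+ j)))
    + r * binomialSum r (suc a) a (λ j → binom (suc a) (suc (s ℕ.+ suc j)))
    ≡⟨ cong₂ (λ x y → x + r * y) near far ⟩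
  (S s + S (suc s)) + r * (S (suc s) + S (2 ℕ.+ s)) ∎
  where
  open ≡-Reasoning
  S = shiftedSum r a
  near : binomialSum r (2 ℕ.+ a) a (λ j → binom (suc a) (suc (s ℕ.+ j))) ≡ S s + S (suc s)
  near = begin
    binomialSum r (2 ℕ.+ a) a (λ j → binom (suc a) (suc (s ℕ.+ j)))
      ≡⟨ binomialSum-cong r (2 ℕ.+ a) a (λ j → binom-pascal a (s ℕ.+ j)) ⟩
    binomialSum r (2 ℕ.+ a) a (λ j → binom a (s ℕ.+ j) + binom a (suc s ℕ.+ j))
      ≡⟨ binomialSum-+ r (2 ℕ.+ a) a (λ j → binom a (s ℕ.+ j)) (λ j → binom a (suc s ℕ.+ j)) ⟩
    binomialSum r (2 ℕ.+ a) a (λ j → binom a (s ℕ.+ j)) + binomialSum r (2 ℕ.+ a) a (λ j → binom a (suc s ℕ.+ j))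
      ≡⟨ cong₂ _+_ (binomialSum-extend r a 1 (λ j → binom a (s ℕ.+ j)))
                   (binomialSum-extend r a 1 (λ j → binom a (suc s ℕ.+ j))) ⟩
    S s + S (suc s) ∎
  far : binomialSum r (suc a) a (λ j → binom (suc a) (suc (s ℕ.+ suc j))) ≡ S (suc s) + S (2 ℕ.+ s)
  far = trans (binomialSum-cong r (suc a) a λ j →
                 trans (binom-pascal a (s ℕ.+ suc j)) (cong (λ i → binom a i + binom a (suc i)) (ℕₚ.+-suc s j)))
              (binomialSum-+ r (suc a) a (λ j → binom a (suc s ℕ.+ j)) (λ j → binom a (2 ℕ.+ s ℕ.+ j)))

shiftedSum-suc₀ : ∀ r a → let S = shiftedSum r a in
  shiftedSum r (suc a) 0 ≡ (S 0 + r * S 1) + r * (S 0 + S 1)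
shiftedSum-suc₀ r a = begin
  shiftedSum r (suc a) 0
    ≡⟨ binomialSum-pascal r (suc a) a (binom (suc a)) ⟩
  binomialSum r (2 ℕ.+ a) a (binom (suc a)) + r * binomialSum r (suc a) a (binom (suc a) ∘ suc)
    ≡⟨ cong₂ (λ x y → x + r * y) squares (binomialSum-cong r (suc a) a (binom-pascal a)) ⟩
  (S 0 + r * S 1) + r * binomialSum r (suc a) a (λ j → binom a j + binom a (suc j))
    ≡⟨ cong (λ y → (S 0 + r * S 1) + r * y) (binomialSum-+ r (suc a) a (binom a) (binom a ∘ suc)) ⟩
  (S 0 + r * S 1) + r * (S 0 + S 1) ∎
  where
  open ≡-Reasoning
  S = shiftedSum r a
  diagonal offDiagonal : ℕ → ℤ
  diagonal    j = binom a (suc j) * binom a (suc j) * r ^ suc j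
  offDiagonal j = binom a j * binom a (suc j) * r ^ j
  pascal-term : ∀ x y r w → x * (y + x) * (r * w) ≡ x * x * (r * w) + r * (y * x * w)
  pascal-term = solve-∀
  regroup : ∀ h A B → h + (A + B) ≡ (h + A) + B
  regroup = solve-∀
  squares : binomialSum r (2 ℕ.+ a) a (binom (suc a)) ≡ S 0 + r * S 1
  squares = begin
    1ℤ + ∑ (suc a) (λ j → binom a (suc j) * binom (suc a) (suc j) * r ^ suc j)
      ≡⟨ cong (_+_ 1ℤ) (∑-cong (suc a) λ j →
           trans (cong (λ b → binom a (suc j) * b * r ^ suc j) (binom-pascal a j))
                 (pascal-term (binom a (suc j)) (binom a j) r (r ^ j))) ⟩
    1ℤ + ∑ (suc a) (λ j → diagonal j + r * offDiagonal j)
      ≡⟨ cong (_+_ 1ℤ) (trans (∑-+ (suc a) diagonal (λ j → r * offDiagonal j))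
                              (cong (_+_ (∑ (suc a) diagonal)) (sym (∑-*ˡ (suc a) r offDiagonal)))) ⟩
    1ℤ + (∑ (suc a) diagonal + r * S 1)
      ≡⟨ regroup 1ℤ (∑ (suc a) diagonal) (r * S 1) ⟩
    binomialSum r (2 ℕ.+ a) a (binom a) + r * S 1
      ≡⟨ cong (_+ r * S 1) (binomialSum-extend r a 1 (binom a)) ⟩
    S 0 + r * S 1 ∎

-- The k = 0 formula is the general one with the convention S(-1) = r·S(1).
stieltjesClosed : ℤ → ℕ → ℕ → ℤ
stieltjesClosed r a zero    = r * shiftedSum r a 0 - r * r * shiftedSum r a 2
stieltjesClosed r a (suc k) = S k + r * S (suc k) - r * S (2 ℕ.+ k) - r * r * S (3 ℕ.+ k)
  where S = shiftedSum r a

stieltjes-closedForm : ∀ r a k → stieltjes r (suc a) k ≡ stieltjesClosed r a k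
stieltjes-closedForm r zero zero = base r
  where
  base : ∀ r → 0ℤ + r * 1ℤ + r * 0ℤ ≡ r * 1ℤ - r * r * 0ℤ
  base = solve-∀
stieltjes-closedForm r zero (suc zero) = base r
  where
  base : ∀ r → 1ℤ + (1ℤ + r) * 0ℤ + r * 0ℤ ≡ 1ℤ + r * 0ℤ - r * 0ℤ - r * r * 0ℤ
  base = solve-∀
stieltjes-closedForm r zero (suc (suc k)) = base r
  where
  base : ∀ r → 0ℤ + (1ℤ + r) * 0ℤ + r * 0ℤ ≡ 0ℤ + r * 0ℤ - r * 0ℤ - r * r * 0ℤ
  base = solve-∀
stieltjes-closedForm r (suc a) zero = begin
  0ℤ + r * stieltjes r (suc a) 0 + r * stieltjes r (suc a) 1
    ≡⟨ cong₂ (λ x y → 0ℤ + r * x + r * y) (stieltjes-closedForm r a 0) (stieltjes-closedForm r a 1) ⟩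
  0ℤ + r * stieltjesClosed r a 0 + r * stieltjesClosed r a 1
    ≡⟨ recurrence r (S 0) (S 1) (S 2) (S 3) ⟩
  r * ((S 0 + r * S 1) + r * (S 0 + S 1)) - r * r * ((S 1 + S 2) + r * (S 2 + S 3))
    ≡⟨ sym (cong₂ (λ x y → r * x - r * r * y) (shiftedSum-suc₀ r a) (shiftedSum-suc r a 1)) ⟩
  stieltjesClosed r (suc a) 0 ∎
  where
  open ≡-Reasoning
  S = shiftedSum r a
  recurrence : ∀ r S₀ S₁ S₂ S₃ →
    0ℤ + r * (r * S₀ - r * r * S₂) + r * (S₀ + r * S₁ - r * S₂ - r * r * S₃)
    ≡ r * ((S₀ + r * S₁) + r * (S₀ + S₁)) - r * r * ((S₁ + S₂) + r * (S₂ + S₃))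
  recurrence = solve-∀
stieltjes-closedForm r (suc a) (suc zero) = begin
  stieltjes r (suc a) 0 + (1ℤ + r) * stieltjes r (suc a) 1 + r * stieltjes r (suc a) 2
    ≡⟨ cong₃ (λ x y z → x + (1ℤ + r) * y + r * z)
             (stieltjes-closedForm r a 0) (stieltjes-closedForm r a 1) (stieltjes-closedForm r a 2) ⟩
  stieltjesClosed r a 0 + (1ℤ + r) * stieltjesClosed r a 1 + r * stieltjesClosed r a 2
    ≡⟨ recurrence r (S 0) (S 1) (S 2) (S 3) (S 4) ⟩
  ((S 0 + r * S 1) + r * (S 0 + S 1)) + r * ((S 0 + S 1) + r * (S 1 + S 2))
    - r * ((S 1 + S 2) + r * (S 2 + S 3)) - r * r * ((S 2 + S 3) + r * (S 3 + S 4))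
    ≡⟨ sym (cong₄ (λ x y z w → x + r * y - r * z - r * r * w)
                  (shiftedSum-suc₀ r a) (shiftedSum-suc r a 0) (shiftedSum-suc r a 1) (shiftedSum-suc r a 2)) ⟩
  stieltjesClosed r (suc a) 1 ∎
  where
  open ≡-Reasoning
  S = shiftedSum r a
  recurrence : ∀ r S₀ S₁ S₂ S₃ S₄ →
    (r * S₀ - r * r * S₂) + (1ℤ + r) * (S₀ + r * S₁ - r * S₂ - r * r * S₃)
      + r * (S₁ + r * S₂ - r * S₃ - r * r * S₄)
    ≡ ((S₀ + r * S₁) + r * (S₀ + S₁)) + r * ((S₀ + S₁) + r * (S₁ + S₂))
      - r * ((S₁ + S₂) + r * (S₂ + S₃)) - r * r * ((S₂ + S₃) + r * (S₃ + S₄))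
  recurrence = solve-∀
stieltjes-closedForm r (suc a) (suc (suc k)) = begin
  stieltjes r (suc a) (suc k) + (1ℤ + r) * stieltjes r (suc a) (2 ℕ.+ k) + r * stieltjes r (suc a) (3 ℕ.+ k)
    ≡⟨ cong₃ (λ x y z → x + (1ℤ + r) * y + r * z) (stieltjes-closedForm r a (suc k))
             (stieltjes-closedForm r a (2 ℕ.+ k)) (stieltjes-closedForm r a (3 ℕ.+ k)) ⟩
  stieltjesClosed r a (suc k) + (1ℤ + r) * stieltjesClosed r a (2 ℕ.+ k) + r * stieltjesClosed r a (3 ℕ.+ k)
    ≡⟨ recurrence r (S k) (S (1 ℕ.+ k)) (S (2 ℕ.+ k)) (S (3 ℕ.+ k)) (S (4 ℕ.+ k)) (S (5 ℕ.+ k)) ⟩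
  ((S k + S (1 ℕ.+ k)) + r * (S (1 ℕ.+ k) + S (2 ℕ.+ k)))
    + r * ((S (1 ℕ.+ k) + S (2 ℕ.+ k)) + r * (S (2 ℕ.+ k) + S (3 ℕ.+ k)))
    - r * ((S (2 ℕ.+ k) + S (3 ℕ.+ k)) + r * (S (3 ℕ.+ k) + S (4 ℕ.+ k)))
    - r * r * ((S (3 ℕ.+ k) + S (4 ℕ.+ k)) + r * (S (4 ℕ.+ k) + S (5 ℕ.+ k)))
    ≡⟨ sym (cong₄ (λ x y z w → x + r * y - r * z - r * r * w) (shiftedSum-suc r a k)
                  (shiftedSum-suc r a (1 ℕ.+ k)) (shiftedSum-suc r a (2 ℕ.+ k)) (shiftedSum-suc r a (3 ℕ.+ k))) ⟩
  stieltjesClosed r (suc a) (2 ℕ.+ k) ∎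
  where
  open ≡-Reasoning
  S = shiftedSum r a
  recurrence : ∀ r S₀ S₁ S₂ S₃ S₄ S₅ →
    (S₀ + r * S₁ - r * S₂ - r * r * S₃) + (1ℤ + r) * (S₁ + r * S₂ - r * S₃ - r * r * S₄)
      + r * (S₂ + r * S₃ - r * S₄ - r * r * S₅)
    ≡ ((S₀ + S₁) + r * (S₁ + S₂)) + r * ((S₁ + S₂) + r * (S₂ + S₃))
      - r * ((S₂ + S₃) + r * (S₃ + S₄)) - r * r * ((S₃ + S₄) + r * (S₄ + S₅))
  recurrence = solve-∀

-- The Hankel determinant

sumTo≡∑ : ∀ m f → sumTo m f ≡ ∑ (suc m) f
sumTo≡∑ zero    f = sym (ℤₚ.+-identityʳ (f 0))
sumTo≡∑ (suc m) f = trans (cong (_+ f (suc m)) (sumTo≡∑ m f)) (sym (∑-last (suc m) f))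

binomDiff-+ : ∀ k m j → binomDiff (k ℕ.+ m) k j ≡ m C j
binomDiff-+ k m j with k ≤ᵇ k ℕ.+ m | ℕₚ.≤⇒≤ᵇ (ℕₚ.m≤m+n k m)
... | true | _ = cong (_C j) (ℕₚ.m+n∸m≡n k m)

T≡binomialSum : ∀ r k m → T (k ℕ.+ m) k r ≡ binomialSum r (suc k) k (binom m)
T≡binomialSum r k m =
  trans (sumTo≡∑ k _) (∑-cong (suc k) λ j → cong (λ b → binom k j * + b * r ^ j) (binomDiff-+ k m j))

T-middle : ∀ r n → T (2 ℕ.* n) n r ≡ shiftedSum r n 0
T-middle r n = trans (cong (λ N → T N n r) (cong (n ℕ.+_) (ℕₚ.+-identityʳ n))) (T≡binomialSum r n n)

T-aboveMiddle : ∀ r a → let S = shiftedSum r a in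
  T (2 ℕ.* suc a) (2 ℕ.+ a) r ≡ (S 0 + r * S 1) + r * (S 1 + r * S 2)
T-aboveMiddle r a = begin
  T (2 ℕ.* suc a) (2 ℕ.+ a) r
    ≡⟨ cong (λ N → T N (2 ℕ.+ a) r) 2[1+a]≡[2+a]+a ⟩
  T ((2 ℕ.+ a) ℕ.+ a) (2 ℕ.+ a) r
    ≡⟨ T≡binomialSum r (2 ℕ.+ a) a ⟩
  binomialSum r (3 ℕ.+ a) (2 ℕ.+ a) (binom a)
    ≡⟨ binomialSum-pascal r (2 ℕ.+ a) (suc a) (binom a) ⟩
  binomialSum r (3 ℕ.+ a) (suc a) (binom a) + r * binomialSum r (2 ℕ.+ a) (suc a) (binom a ∘ suc)
    ≡⟨ cong₂ (λ x y → x + r * y) (binomialSum-pascal r (2 ℕ.+ a) a (binom a))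
                                 (binomialSum-pascal r (suc a) a (binom a ∘ suc)) ⟩
  (binomialSum r (3 ℕ.+ a) a (binom a) + r * binomialSum r (2 ℕ.+ a) a (binom a ∘ suc))
    + r * (binomialSum r (2 ℕ.+ a) a (binom a ∘ suc) + r * S 2)
    ≡⟨ cong₃ (λ x y z → (x + r * y) + r * (z + r * S 2)) (binomialSum-extend r a 2 (binom a))
             (binomialSum-extend r a 1 (binom a ∘ suc)) (binomialSum-extend r a 1 (binom a ∘ suc)) ⟩
  (S 0 + r * S 1) + r * (S 1 + r * S 2) ∎
  where
  open ≡-Reasoning
  S = shiftedSum r a
  2[1+a]≡[2+a]+a : 2 ℕ.* suc a ≡ (2 ℕ.+ a) ℕ.+ a
  2[1+a]≡[2+a]+a = cong suc (trans (ℕₚ.+-suc a (a ℕ.+ 0)) (cong (suc ∘ (a ℕ.+_)) (ℕₚ.+-identityʳ a)))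

catalan≡stieltjes : ∀ r n → catalan r n ≡ stieltjes r n 0
catalan≡stieltjes r zero    = refl
catalan≡stieltjes r (suc a) = begin
  T (2 ℕ.* suc a) (suc a) r - T (2 ℕ.* suc a) (2 ℕ.+ a) r
    ≡⟨ cong₂ _-_ (trans (T-middle r (suc a)) (shiftedSum-suc₀ r a)) (T-aboveMiddle r a) ⟩
  ((S 0 + r * S 1) + r * (S 0 + S 1)) - ((S 0 + r * S 1) + r * (S 1 + r * S 2))
    ≡⟨ difference r (S 0) (S 1) (S 2) ⟩
  stieltjesClosed r a 0
    ≡⟨ sym (stieltjes-closedForm r a 0) ⟩
  stieltjes r (suc a) 0 ∎
  where
  open ≡-Reasoning
  S = shiftedSum r a
  difference : ∀ r S₀ S₁ S₂ →
    ((S₀ + r * S₁) + r * (S₀ + S₁)) - ((S₀ + r * S₁) + r * (S₁ + r * S₂)) ≡ r * S₀ - r * r * S₂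
  difference = solve-∀

hankel-LDLᵀ : ∀ r N {a} c → a < N →
              catalan r (a ℕ.+ c) ≡ ∑ N (λ k → stieltjes r a k * (r ^ k * stieltjes r c k))
hankel-LDLᵀ r N {a} c a<N =
  trans (catalan≡stieltjes r (a ℕ.+ c))
  (sym (trans (∑-cong N λ k → sym (ℤₚ.*-assoc (stieltjes r a k) (r ^ k) (stieltjes r c k)))
              (stieltjes-moments r a c N a<N)))

mainTheorem3 : (r : ℤ) (n : ℕ) → hankel (catalan r) n ≡ r ^ ((suc n) C 2)
mainTheorem3 r n = begin
  hankel (catalan r) n
    ≡⟨ det≡laplace N H toℕ ⟩
  laplace N H (tabulate toℕ)
    ≡⟨ cong (laplace N H) (tabulate-toℕ N (λ a → a)) ⟩
  laplace N H (upTo N)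
    ≡⟨ laplace-cong N (upTo N) (λ a a<N c → hankel-LDLᵀ r N c a<N) ⟩
  laplace N (λ a c → ∑ N (λ k → L a k * DLᵀ k c)) (upTo N)
    ≡⟨ laplace-unitLowerTriangular-* N L DLᵀ (upTo N) (stieltjes-diagonal r) (stieltjes-upper r) ⟩
  laplace N DLᵀ (upTo N)
    ≡⟨ laplace-upperTriangular N DLᵀ (λ a → a) (λ a<b → a<b) DLᵀ-upper ⟩
  ∏ N (λ a → DLᵀ a a)
    ≡⟨ ∏-cong N DLᵀ-diagonal ⟩
  ∏ N (r ^_)
    ≡⟨ ∏-powers r n ⟩
  r ^ (N C 2) ∎
  where
  open ≡-Reasoning
  N = suc n
  H L DLᵀ : Matrix
  H a c = catalan r (a ℕ.+ c)
  L = stieltjes r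
  DLᵀ k c = r ^ k * L c k
  DLᵀ-upper : ∀ {a c} → c < a → DLᵀ a c ≡ 0ℤ
  DLᵀ-upper {a} c<a = trans (cong (_*_ (r ^ a)) (stieltjes-upper r c<a)) (ℤₚ.*-zeroʳ (r ^ a))
  DLᵀ-diagonal : ∀ a → DLᵀ a a ≡ r ^ a
  DLᵀ-diagonal a = trans (cong (_*_ (r ^ a)) (stieltjes-diagonal r a)) (ℤₚ.*-identityʳ (r ^ a))
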